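{- Let $n,b$ be integers with $1\le b<n$, and let $m\ge3$. Then $t(n,b)=m$ if and only if $\frac bn\in K_m$.
   Context: $f_k$ are the Fibonacci numbers, $f_1=f_2=1$, $f_{k+2}=f_{k+1}+f_k$, $f_0=0$. The reverse Fibonacci walk $R(n,b)=(r_1,r_2,\dots)$ is defined by $r_1=n$, $r_2=b$, $r_{k+2}=r_k-r_{k+1}$, and $t(n,b)$ is the largest index $t$ such that $r_1,\dots,r_t$ are all positive. For $u\ge1$ define the intervals $K_{2u+1}=\left(\frac{f_{2u-2}}{f_{2u-1}},\frac{f_{2u}}{f_{2u+1}}\right]$ and $K_{2u+2}=\left[\frac{f_{2u+1}}{f_{2u+2}},\frac{f_{2u-1}}{f_{2u}}\right)$. -}

module Defs where

open import Data.Nat using (ℕ; zero; suc; _≤_; _*_; _+_)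
open import Data.Integer as ℤ using (ℤ; +_)
open import Data.Rational as ℚ using (ℚ; 0ℚ)
open import Data.Product using (Σ; _×_)
open import Data.Sum using (_⊎_)

fib : ℕ → ℕ
fib 0 = 0
fib 1 = 1
fib (suc (suc k)) = fib (suc k) + fib k

-- Reverse Fibonacci walk R(n,b), 1-indexed: walk n b 1 = n, walk n b 2 = b,
-- walk n b (k+2) = walk n b k - walk n b (k+1).  (Index 0 is a dummy value.)
walkPair : ℤ → ℤ → ℕ → ℤ × ℤ
walkPair n b zero = n Data.Product., b
walkPair n b (suc k) with walkPair n b k
... | x Data.Product., y = y Data.Product., (x ℤ.- y)

walk : ℤ → ℤ → ℕ → ℤ
walk n b zero = ℤ.0ℤ
walk n b (suc k) = Data.Product.proj₁ (walkPair n b k)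

AllPos : ℤ → ℤ → ℕ → Set
AllPos n b t = ∀ k → 1 ≤ k → k ≤ t → ℤ.0ℤ ℤ.< walk n b k

IsT : ℤ → ℤ → ℕ → Set
IsT n b m = AllPos n b m × (∀ t → AllPos n b t → t ≤ m)

-- the fraction a/d as a rational (only used with d ≥ 1)
_÷_ : ℕ → ℕ → ℚ
a ÷ zero = 0ℚ
a ÷ suc d = (+ a) ℚ./ suc d

-- K_{2u+1} = ( f_{2u-2}/f_{2u-1} , f_{2u}/f_{2u+1} ]   (u ≥ 1; written with u = v+1)
KOdd : ℕ → ℚ → Set
KOdd v q = (fib (2 * v) ÷ fib (2 * v + 1)) ℚ.< q × q ℚ.≤ (fib (2 * v + 2) ÷ fib (2 * v + 3))

-- K_{2u+2} = [ f_{2u+1}/f_{2u+2} , f_{2u-1}/f_{2u} )   (u ≥ 1; written with u = v+1)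
KEven : ℕ → ℚ → Set
KEven v q = (fib (2 * v + 3) ÷ fib (2 * v + 4)) ℚ.≤ q × q ℚ.< (fib (2 * v + 1) ÷ fib (2 * v + 2))

InK : ℕ → ℚ → Set
InK m q = Σ ℕ (λ v → (m Relation.Binary.PropositionalEquality.≡ 2 * (suc v) + 1 × KOdd v q)
                     ⊎ (m Relation.Binary.PropositionalEquality.≡ 2 * (suc v) + 2 × KEven v q))
  where import Relation.Binary.PropositionalEquality

{-# OPTIONS --safe #-}
module Submission where

-- Stepping two indices at a time, r_{2+2v} = b f_{2v+1} - n f_{2v} and
-- r_{3+2v} = n f_{2v+1} - b f_{2v+2}.  Since r_k = r_{k+1} + r_{k+2}, positivity of two
-- consecutive terms propagates backwards, so t(n,b) = k+2 exactly when r_{k+1} > 0 >= r_{k+3}.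
-- By the closed forms these two sign conditions are, after cross-multiplying, the two
-- endpoint inequalities of K_{k+2}.

open import Defs
open import Data.Nat using (ℕ; _≤_; _<_)
open import Data.Integer using (+_)
open import Data.Product using (_×_)

open import Data.Nat using (zero; suc; _+_; _*_; z≤n; s≤s)
import Data.Nat.Properties as ℕₚ
import Data.Nat.Tactic.RingSolver as ℕ-Solver
open import Data.Integer as ℤ using (ℤ; 0ℤ)
import Data.Integer.Properties as ℤₚ
import Data.Integer.Tactic.RingSolver as ℤ-Solver
import Data.Rational as ℚ
import Data.Rational.Properties as ℚₚ
open import Data.Rational.Unnormalised as ℚᵘ using (mkℚᵘ)
import Data.Rational.Unnormalised.Properties as ℚᵘₚ
open import Data.Product using (_,_; ∃-syntax; swap)
open import Data.Product.Function.NonDependent.Propositional using (_×-⇔_)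
open import Data.Sum using (_⊎_; inj₁; inj₂)
open import Function.Bundles using (_⇔_; mk⇔; Equivalence)
open import Function.Construct.Composition using (_⇔-∘_)
open import Function.Construct.Symmetry using (⇔-sym)
import Function.Related.Propositional as Related
open import Relation.Binary.PropositionalEquality
  using (_≡_; refl; sym; trans; cong; cong₂; subst; module ≡-Reasoning)

fromℚᵘ-<-⇔ : ∀ p q → ℚ.fromℚᵘ p ℚ.< ℚ.fromℚᵘ q ⇔ p ℚᵘ.< q
fromℚᵘ-<-⇔ p q = mk⇔
  (λ lt → ℚᵘₚ.<-respʳ-≃ (ℚₚ.toℚᵘ-fromℚᵘ q) (ℚᵘₚ.<-respˡ-≃ (ℚₚ.toℚᵘ-fromℚᵘ p) (ℚₚ.toℚᵘ-mono-< lt)))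
  (λ lt → ℚₚ.toℚᵘ-cancel-< (ℚᵘₚ.<-respʳ-≃ (ℚᵘₚ.≃-sym (ℚₚ.toℚᵘ-fromℚᵘ q))
                             (ℚᵘₚ.<-respˡ-≃ (ℚᵘₚ.≃-sym (ℚₚ.toℚᵘ-fromℚᵘ p)) lt)))

fromℚᵘ-≤-⇔ : ∀ p q → ℚ.fromℚᵘ p ℚ.≤ ℚ.fromℚᵘ q ⇔ p ℚᵘ.≤ q
fromℚᵘ-≤-⇔ p q = mk⇔
  (λ le → ℚᵘₚ.≤-respʳ-≃ (ℚₚ.toℚᵘ-fromℚᵘ q) (ℚᵘₚ.≤-respˡ-≃ (ℚₚ.toℚᵘ-fromℚᵘ p) (ℚₚ.toℚᵘ-mono-≤ le)))
  (λ le → ℚₚ.toℚᵘ-cancel-≤ (ℚᵘₚ.≤-respʳ-≃ (ℚᵘₚ.≃-sym (ℚₚ.toℚᵘ-fromℚᵘ q))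
                             (ℚᵘₚ.≤-respˡ-≃ (ℚᵘₚ.≃-sym (ℚₚ.toℚᵘ-fromℚᵘ p)) le)))

÷-<-÷-⇔ : ∀ {a d c e} → 0 < d → 0 < e → (a ÷ d) ℚ.< (c ÷ e) ⇔ + a ℤ.* + e ℤ.< + c ℤ.* + d
÷-<-÷-⇔ {a} {suc d} {c} {suc e} _ _ =
  mk⇔ ℚᵘₚ.drop-*<* ℚᵘ.*<* ⇔-∘ fromℚᵘ-<-⇔ (mkℚᵘ (+ a) d) (mkℚᵘ (+ c) e)

÷-≤-÷-⇔ : ∀ {a d c e} → 0 < d → 0 < e → (a ÷ d) ℚ.≤ (c ÷ e) ⇔ + a ℤ.* + e ℤ.≤ + c ℤ.* + d
÷-≤-÷-⇔ {a} {suc d} {c} {suc e} _ _ =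
  mk⇔ ℚᵘₚ.drop-*≤* ℚᵘ.*≤* ⇔-∘ fromℚᵘ-≤-⇔ (mkℚᵘ (+ a) d) (mkℚᵘ (+ c) e)

0<i-j⇔j<i : ∀ {i j} → 0ℤ ℤ.< i ℤ.- j ⇔ j ℤ.< i
0<i-j⇔j<i = mk⇔
  (λ 0<i-j → ℤₚ.≰⇒> (λ i≤j → ℤₚ.<⇒≱ 0<i-j (ℤₚ.i≤j⇒i-j≤0 i≤j)))
  (λ j<i → ℤₚ.≰⇒> (λ i-j≤0 → ℤₚ.<⇒≱ j<i (ℤₚ.i-j≤0⇒i≤j i-j≤0)))

i-j≤0⇔i≤j : ∀ {i j} → i ℤ.- j ℤ.≤ 0ℤ ⇔ i ℤ.≤ j
i-j≤0⇔i≤j = mk⇔ ℤₚ.i-j≤0⇒i≤j ℤₚ.i≤j⇒i-j≤0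

fib-pos : ∀ k → 0 < fib (suc k)
fib-pos zero    = s≤s z≤n
fib-pos (suc k) = ℕₚ.≤-trans (fib-pos k) (ℕₚ.m≤m+n _ _)

walk-rec : ∀ x y k → walk x y (3 + k) ≡ walk x y (1 + k) ℤ.- walk x y (2 + k)
walk-rec x y k with walkPair x y k
... | _ , _ = refl

+fib-rec : ∀ k → + fib (2 + k) ≡ + fib (1 + k) ℤ.+ + fib k
+fib-rec k = ℤₚ.pos-+ (fib (1 + k)) (fib k)

-- Indexed by v * 2 rather than 2 * v because suc v * 2 reduces to 2 + v * 2.
walk-even : ∀ x y v → walk x y (2 + v * 2) ≡ y ℤ.* + fib (1 + v * 2) ℤ.- + fib (v * 2) ℤ.* x
walk-odd  : ∀ x y v → walk x y (3 + v * 2) ≡ + fib (1 + v * 2) ℤ.* x ℤ.- y ℤ.* + fib (2 + v * 2)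

walk-even x y zero = base x y
  where
    base : ∀ x y → y ≡ y ℤ.* + 1 ℤ.- + 0 ℤ.* x
    base = ℤ-Solver.solve-∀
walk-even x y (suc v) = begin
  walk x y (4 + w)
    ≡⟨ walk-rec x y (1 + w) ⟩
  walk x y (2 + w) ℤ.- walk x y (3 + w)
    ≡⟨ cong₂ ℤ._-_ (walk-even x y v) (walk-odd x y v) ⟩
  (y ℤ.* f₁ ℤ.- f₀ ℤ.* x) ℤ.- (f₁ ℤ.* x ℤ.- y ℤ.* f₂)
    ≡⟨ regroup f₀ f₁ f₂ x y ⟩
  y ℤ.* (f₂ ℤ.+ f₁) ℤ.- (f₁ ℤ.+ f₀) ℤ.* x
    ≡⟨ cong₂ (λ p q → y ℤ.* p ℤ.- q ℤ.* x) (sym (+fib-rec (1 + w))) (sym (+fib-rec w)) ⟩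
  y ℤ.* + fib (3 + w) ℤ.- + fib (2 + w) ℤ.* x
    ∎
  where
    open ≡-Reasoning
    w : ℕ
    w = v * 2
    f₀ f₁ f₂ : ℤ
    f₀ = + fib w
    f₁ = + fib (1 + w)
    f₂ = + fib (2 + w)
    regroup : ∀ a b c x y →
      (y ℤ.* b ℤ.- a ℤ.* x) ℤ.- (b ℤ.* x ℤ.- y ℤ.* c) ≡ y ℤ.* (c ℤ.+ b) ℤ.- (b ℤ.+ a) ℤ.* x
    regroup = ℤ-Solver.solve-∀

walk-odd x y zero = base x y
  where
    base : ∀ x y → x ℤ.- y ≡ + 1 ℤ.* x ℤ.- y ℤ.* + 1
    base = ℤ-Solver.solve-∀
walk-odd x y (suc v) = begin
  walk x y (5 + w)
    ≡⟨ walk-rec x y (2 + w) ⟩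
  walk x y (3 + w) ℤ.- walk x y (4 + w)
    ≡⟨ cong₂ ℤ._-_ (walk-odd x y v) (walk-even x y (suc v)) ⟩
  (f₁ ℤ.* x ℤ.- y ℤ.* f₂) ℤ.- (y ℤ.* f₃ ℤ.- f₂ ℤ.* x)
    ≡⟨ regroup f₁ f₂ f₃ x y ⟩
  (f₂ ℤ.+ f₁) ℤ.* x ℤ.- y ℤ.* (f₃ ℤ.+ f₂)
    ≡⟨ cong₂ (λ p q → p ℤ.* x ℤ.- y ℤ.* q) (sym (+fib-rec (1 + w))) (sym (+fib-rec (2 + w))) ⟩
  + fib (3 + w) ℤ.* x ℤ.- y ℤ.* + fib (4 + w)
    ∎
  where
    open ≡-Reasoning
    w : ℕ
    w = v * 2
    f₁ f₂ f₃ : ℤ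
    f₁ = + fib (1 + w)
    f₂ = + fib (2 + w)
    f₃ = + fib (3 + w)
    regroup : ∀ b c d x y →
      (b ℤ.* x ℤ.- y ℤ.* c) ℤ.- (y ℤ.* d ℤ.- c ℤ.* x) ≡ (c ℤ.+ b) ℤ.* x ℤ.- y ℤ.* (d ℤ.+ c)
    regroup = ℤ-Solver.solve-∀

allPos-from-last-two : ∀ {x y} k →
  0ℤ ℤ.< walk x y (1 + k) → 0ℤ ℤ.< walk x y (2 + k) → AllPos x y (2 + k)
allPos-from-last-two zero    p q (suc zero)       _ _                    = p
allPos-from-last-two zero    p q (suc (suc zero)) _ _                    = q
allPos-from-last-two zero    p q (suc (suc (suc _))) _ (s≤s (s≤s ()))
allPos-from-last-two {x} {y} (suc k) p q j 1≤j j≤2+k with ℕₚ.m≤n⇒m<n∨m≡n j≤2+k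
... | inj₂ refl       = q
... | inj₁ (s≤s j≤1+k) = allPos-from-last-two k p′ p j 1≤j j≤1+k
  where
    -- r_{k+1} = r_{k+2} + r_{k+3} with both summands positive
    p′ : 0ℤ ℤ.< walk x y (1 + k)
    p′ = ℤₚ.<-trans p (Equivalence.to 0<i-j⇔j<i (subst (0ℤ ℤ.<_) (walk-rec x y k) q))

IsT-⇔ : ∀ {x y} k → IsT x y (2 + k) ⇔ (0ℤ ℤ.< walk x y (1 + k) × walk x y (3 + k) ℤ.≤ 0ℤ)
IsT-⇔ {x} {y} k = mk⇔ stops stopsAt
  where
    stops : IsT x y (2 + k) → 0ℤ ℤ.< walk x y (1 + k) × walk x y (3 + k) ℤ.≤ 0ℤ
    stops (allPos , maximal) = r₁>0 , ℤₚ.≮⇒≥ λ r₃>0 →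
      ℕₚ.n≮n _ (maximal (3 + k) (allPos-from-last-two (1 + k) r₂>0 r₃>0))
      where
        r₁>0 : 0ℤ ℤ.< walk x y (1 + k)
        r₁>0 = allPos (1 + k) (s≤s z≤n) (ℕₚ.n≤1+n _)
        r₂>0 : 0ℤ ℤ.< walk x y (2 + k)
        r₂>0 = allPos (2 + k) (s≤s z≤n) ℕₚ.≤-refl

    stopsAt : 0ℤ ℤ.< walk x y (1 + k) × walk x y (3 + k) ℤ.≤ 0ℤ → IsT x y (2 + k)
    stopsAt (r₁>0 , r₃≤0) = allPos-from-last-two k r₁>0 r₂>0 , maximal
      where
        r₂>0 : 0ℤ ℤ.< walk x y (2 + k)
        r₂>0 = ℤₚ.<-≤-trans r₁>0 (ℤₚ.i-j≤0⇒i≤j (subst (ℤ._≤ 0ℤ) (walk-rec x y k) r₃≤0))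
        maximal : ∀ t → AllPos x y t → t ≤ 2 + k
        maximal t allPos = ℕₚ.≮⇒≥ λ 2+k<t → ℤₚ.<⇒≱ (allPos (3 + k) (s≤s z≤n) 2+k<t) r₃≤0

KOdd-unfold : ∀ v q → KOdd v q ≡
  ((fib (v * 2) ÷ fib (1 + v * 2)) ℚ.< q × q ℚ.≤ (fib (2 + v * 2) ÷ fib (3 + v * 2)))
KOdd-unfold v q
  rewrite ℕₚ.*-comm 2 v | ℕₚ.+-comm (v * 2) 1 | ℕₚ.+-comm (v * 2) 2 | ℕₚ.+-comm (v * 2) 3 = refl

KEven-unfold : ∀ v q → KEven v q ≡
  ((fib (3 + v * 2) ÷ fib (4 + v * 2)) ℚ.≤ q × q ℚ.< (fib (1 + v * 2) ÷ fib (2 + v * 2)))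
KEven-unfold v q
  rewrite ℕₚ.*-comm 2 v | ℕₚ.+-comm (v * 2) 1 | ℕₚ.+-comm (v * 2) 2
        | ℕₚ.+-comm (v * 2) 3 | ℕₚ.+-comm (v * 2) 4 = refl

2[1+v]+1≡3+v*2 : ∀ v → 2 * suc v + 1 ≡ 3 + v * 2
2[1+v]+1≡3+v*2 = ℕ-Solver.solve-∀

2[1+v]+2≡4+v*2 : ∀ v → 2 * suc v + 2 ≡ 4 + v * 2
2[1+v]+2≡4+v*2 = ℕ-Solver.solve-∀

module _ {n : ℕ} (b : ℕ) (n>0 : 0 < n) where
  open Related.EquationalReasoning

  IsT-odd-⇔ : ∀ v → IsT (+ n) (+ b) (2 * suc v + 1) ⇔ KOdd v (b ÷ n)
  IsT-odd-⇔ v = begin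
    IsT (+ n) (+ b) (2 * suc v + 1)
      ≡⟨ cong (IsT (+ n) (+ b)) (2[1+v]+1≡3+v*2 v) ⟩
    IsT (+ n) (+ b) (2 + (1 + w))
      ∼⟨ IsT-⇔ (1 + w) ⟩
    (0ℤ ℤ.< walk (+ n) (+ b) (2 + w) × walk (+ n) (+ b) (4 + w) ℤ.≤ 0ℤ)
      ≡⟨ cong₂ (λ r s → 0ℤ ℤ.< r × s ℤ.≤ 0ℤ) (walk-even _ _ v) (walk-even _ _ (suc v)) ⟩
    (0ℤ ℤ.< + b ℤ.* + fib (1 + w) ℤ.- + fib w ℤ.* + n ×
     + b ℤ.* + fib (3 + w) ℤ.- + fib (2 + w) ℤ.* + n ℤ.≤ 0ℤ)
      ∼⟨ 0<i-j⇔j<i ×-⇔ i-j≤0⇔i≤j ⟩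
    (+ fib w ℤ.* + n ℤ.< + b ℤ.* + fib (1 + w) ×
     + b ℤ.* + fib (3 + w) ℤ.≤ + fib (2 + w) ℤ.* + n)
      ∼⟨ ⇔-sym (÷-<-÷-⇔ (fib-pos w) n>0 ×-⇔ ÷-≤-÷-⇔ n>0 (fib-pos (2 + w))) ⟩
    ((fib w ÷ fib (1 + w)) ℚ.< (b ÷ n) × (b ÷ n) ℚ.≤ (fib (2 + w) ÷ fib (3 + w)))
      ≡⟨ sym (KOdd-unfold v (b ÷ n)) ⟩
    KOdd v (b ÷ n) ∎
    where
      w : ℕ
      w = v * 2

  IsT-even-⇔ : ∀ v → IsT (+ n) (+ b) (2 * suc v + 2) ⇔ KEven v (b ÷ n)
  IsT-even-⇔ v = begin
    IsT (+ n) (+ b) (2 * suc v + 2)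
      ≡⟨ cong (IsT (+ n) (+ b)) (2[1+v]+2≡4+v*2 v) ⟩
    IsT (+ n) (+ b) (2 + (2 + w))
      ∼⟨ IsT-⇔ (2 + w) ⟩
    (0ℤ ℤ.< walk (+ n) (+ b) (3 + w) × walk (+ n) (+ b) (5 + w) ℤ.≤ 0ℤ)
      ≡⟨ cong₂ (λ r s → 0ℤ ℤ.< r × s ℤ.≤ 0ℤ) (walk-odd _ _ v) (walk-odd _ _ (suc v)) ⟩
    (0ℤ ℤ.< + fib (1 + w) ℤ.* + n ℤ.- + b ℤ.* + fib (2 + w) ×
     + fib (3 + w) ℤ.* + n ℤ.- + b ℤ.* + fib (4 + w) ℤ.≤ 0ℤ)
      ∼⟨ 0<i-j⇔j<i ×-⇔ i-j≤0⇔i≤j ⟩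
    (+ b ℤ.* + fib (2 + w) ℤ.< + fib (1 + w) ℤ.* + n ×
     + fib (3 + w) ℤ.* + n ℤ.≤ + b ℤ.* + fib (4 + w))
      ∼⟨ ⇔-sym (÷-<-÷-⇔ n>0 (fib-pos (1 + w)) ×-⇔ ÷-≤-÷-⇔ (fib-pos (3 + w)) n>0) ⟩
    ((b ÷ n) ℚ.< (fib (1 + w) ÷ fib (2 + w)) × (fib (3 + w) ÷ fib (4 + w)) ℚ.≤ (b ÷ n))
      ∼⟨ mk⇔ swap swap ⟩
    ((fib (3 + w) ÷ fib (4 + w)) ℚ.≤ (b ÷ n) × (b ÷ n) ℚ.< (fib (1 + w) ÷ fib (2 + w)))
      ≡⟨ sym (KEven-unfold v (b ÷ n)) ⟩
    KEven v (b ÷ n) ∎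
    where
      w : ℕ
      w = v * 2

odd-or-even-≥3 : ∀ m → 3 ≤ m → ∃[ v ] (m ≡ 2 * suc v + 1 ⊎ m ≡ 2 * suc v + 2)
odd-or-even-≥3 1 (s≤s ())
odd-or-even-≥3 2 (s≤s (s≤s ()))
odd-or-even-≥3 3 _ = 0 , inj₁ refl
odd-or-even-≥3 4 _ = 0 , inj₂ refl
odd-or-even-≥3 (suc (suc m@(suc (suc (suc _))))) _ with odd-or-even-≥3 m (s≤s (s≤s (s≤s z≤n)))
... | v , inj₁ eq = suc v , inj₁ (trans (cong (λ k → 2 + k) eq) (cong (_+ 1) (sym (ℕₚ.*-suc 2 (suc v)))))
... | v , inj₂ eq = suc v , inj₂ (trans (cong (λ k → 2 + k) eq) (cong (_+ 2) (sym (ℕₚ.*-suc 2 (suc v)))))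

proposition18 : (n b : ℕ) → 1 ≤ b → b < n → (m : ℕ) → 3 ≤ m →
    (IsT (+ n) (+ b) m → InK m (b ÷ n)) × (InK m (b ÷ n) → IsT (+ n) (+ b) m)
proposition18 n b _ b<n m 3≤m = toK , fromK
  where
    n>0 : 0 < n
    n>0 = ℕₚ.≤-<-trans z≤n b<n

    toK : IsT (+ n) (+ b) m → InK m (b ÷ n)
    toK t with odd-or-even-≥3 m 3≤m
    ... | v , inj₁ refl = v , inj₁ (refl , Equivalence.to (IsT-odd-⇔ b n>0 v) t)
    ... | v , inj₂ refl = v , inj₂ (refl , Equivalence.to (IsT-even-⇔ b n>0 v) t)

    fromK : InK m (b ÷ n) → IsT (+ n) (+ b) m
    fromK (v , inj₁ (refl , K)) = Equivalence.from (IsT-odd-⇔ b n>0 v) K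
    fromK (v , inj₂ (refl , K)) = Equivalence.from (IsT-even-⇔ b n>0 v) K
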